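{- Let $n\ge2$, $m\ge1$, let $v$ be a vertex of the dYoke graph $Z_{n,m}$, let $P$ be a pivot path of $v$, and let $I=[p_1+1,p_2]$ be a $P$-interval. (1) If $p_2=m+1$, $P$ shifts left in $I$, and $\sum_{i=j}^{m+1}v_i\ge0$ for every $j\in I$, then no step of $P$ is a left unit shift from an empty right bucket (i.e., no step applies $\overleftarrow{s}_m$ to a vertex whose last entry is $0$). (2) If $p_1=-1$, $P$ shifts right in $I$, and $\sum_{i=0}^{j}v_i\ge0$ for every $j\in I$, then no step of $P$ is a right unit shift from an empty left bucket (i.e., no step applies $\overrightarrow{s}_0$ to a vertex whose first entry is $0$).
   Context: Elements of $\mathbb{Z}_n$ are identified with their smallest nonnegative representatives in $\{0,\dots,n-1\}$ (so $v_0,v_{m+1}$ are integers in $[0,n-1]$ in the sums). The dYoke graph $Z_{n,m}$ has as vertices all tuples $u=(u_0,\dots,u_{m+1})$ with $u_0,u_{m+1}\in\mathbb{Z}_n$, $u_1,\dots,u_m\in\{ -1,0,1\}$ and $\sum_{i=0}^{m+1}u_i\equiv0\pmod n$; adjacency: there is $0\le i\le m$ with $u_j=v_j$ for $j\notin\{i,i+1\}$ and either ($u_i=v_i+1$, $u_{i+1}=v_{i+1}-1$) or ($u_i=v_i-1$, $u_{i+1}=v_{i+1}+1$), arithmetic in coordinates $0,m+1$ in $\mathbb{Z}_n$. $0$ is the all-zero vertex. For $0\le i\le m$, $\overleftarrow{s}_i(v)$ is obtained from $v$ by adding $1$ to entry $i$ and subtracting $1$ from entry $i+1$ if the result is a vertex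 (and is $v$ otherwise); $\overrightarrow{s}_i(v)$ subtracts $1$ from entry $i$ and adds $1$ to entry $i+1$. The word of a path $v^0\sim\dots\sim v^d$ is $f_d\cdots f_1$ with $f_t(v^{t-1})=v^t$. For a path $P$ from $v$ to $0$ with word $w$: $0\le p\le m$ is an inner wall if neither $\overleftarrow{s}_p$ nor $\overrightarrow{s}_p$ occurs in $w$; $-1$ is a wall if $\overleftarrow{s}_0$ does not occur in $w$; $m+1$ is a wall if $\overrightarrow{s}_m$ does not occur in $w$. A $p$-pivot path of $v$ is a shortest path among all paths from $v$ to $0$ having $p$ as a wall; a pivot path is a $p$-pivot path for some $p$. If $p_1<\dots<p_t$ are the inner walls of a pivot path $P$, set $p_0=-1$, $p_{t+1}=m+1$; the $P$-intervals are $[p_k+1,p_{k+1}]$, $0\le k\le t$. All letters $s_k$ with $[k,k+1]\subseteq I$ occurring in the word of $P$ shift in a common direction; $P$ shifts left (right) in $I$ if this direction is left (right). -}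

module Defs where

open import Data.Nat as ℕ using (ℕ; zero; suc; _≡ᵇ_; _≤ᵇ_)
open import Data.Integer as ℤ using (ℤ; +_; 0ℤ; 1ℤ; -1ℤ; _+_; -_; _≤_; _<_)
open import Data.Integer.DivMod using (_%ℕ_)
open import Data.Integer.Divisibility using (_∣_)
open import Data.Fin using (Fin; toℕ; fromℕ; inject₁) renaming (zero to fzero; suc to fsuc)
open import Data.Bool using (Bool; true; false; if_then_else_; _∨_; T)
open import Data.List using (List; []; _∷_; length)
open import Data.List.Membership.Propositional using (_∈_; _∉_)
open import Data.List.Relation.Unary.All using (All)
open import Data.Product using (Σ; _×_; _,_)
open import Data.Sum using (_⊎_)
open import Data.Unit using (⊤)
open import Relation.Binary.PropositionalEquality using (_≡_)
open import Relation.Nullary using (¬_)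

-- Configurations: tuples (u_0,…,u_{m+1}) of integers, indexed by Fin (m+2).
-- The end coordinates u_0,u_{m+1} ∈ ℤ_n are stored as their smallest
-- nonnegative representatives.

Config : ℕ → Set
Config m = Fin (suc (suc m)) → ℤ

sumℤ : ∀ {k} → (Fin k → ℤ) → ℤ
sumℤ {zero}  f = 0ℤ
sumℤ {suc k} f = f fzero + sumℤ (λ i → f (fsuc i))

sumFrom : ∀ {m} → ℕ → Config m → ℤ
sumFrom j u = sumℤ (λ i → if j ≤ᵇ toℕ i then u i else 0ℤ)

sumUpTo : ∀ {m} → ℕ → Config m → ℤ
sumUpTo j u = sumℤ (λ i → if toℕ i ≤ᵇ j then u i else 0ℤ)

isEndᵇ : ∀ {m} → Fin (suc (suc m)) → Bool
isEndᵇ {m} j = (toℕ j ≡ᵇ 0) ∨ (toℕ j ≡ᵇ suc m)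

IsEnd : ∀ {m} → Fin (suc (suc m)) → Set
IsEnd j = T (isEndᵇ j)

record IsVertex (n m : ℕ) (u : Config m) : Set where
  field
    end-range   : ∀ j → IsEnd j → (0ℤ ≤ u j) × (u j < + n)
    inner-range : ∀ j → ¬ IsEnd j → (-1ℤ ≤ u j) × (u j ≤ 1ℤ)
    sum-zero    : (+ n) ∣ sumℤ u

reduce : ℕ → ℤ → ℤ
reduce zero    x = x
reduce (suc k) x = + (x %ℕ suc k)

adjust : (n m : ℕ) → Fin (suc (suc m)) → ℤ → ℤ → ℤ
adjust n m j δ x = if isEndᵇ j then reduce n (x + δ) else x + δ

-- Letters: ←s_i (L , i) and →s_i (R , i) for 0 ≤ i ≤ m.

data Dir : Set where
  L R : Dir

Letter : ℕ → Set
Letter m = Dir × Fin (suc m)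

δ : Dir → ℤ
δ L = 1ℤ
δ R = -1ℤ

-- ←s_i adds 1 to entry i and subtracts 1 from entry i+1;
-- →s_i subtracts 1 from entry i and adds 1 to entry i+1.
-- (raw result, before checking that it is a vertex)
raw : (n m : ℕ) → Letter m → Config m → Config m
raw n m (d , i) u j =
  if toℕ j ≡ᵇ toℕ i then adjust n m j (δ d) (u j)
  else if toℕ j ≡ᵇ suc (toℕ i) then adjust n m j (- δ d) (u j)
  else u j

-- the letter moves u along an edge iff its raw result is a vertex
Applicable : (n m : ℕ) → Letter m → Config m → Set
Applicable n m ℓ u = IsVertex n m (raw n m ℓ u)

-- A path starting at u is given by its letters in order of application
-- (f_1 first); each letter must be applicable at the current vertex.
ValidWord : (n m : ℕ) → Config m → List (Letter m) → Set
ValidWord n m u []      = ⊤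
ValidWord n m u (ℓ ∷ w) = Applicable n m ℓ u × ValidWord n m (raw n m ℓ u) w

run : (n m : ℕ) → Config m → List (Letter m) → Config m
run n m u []      = u
run n m u (ℓ ∷ w) = run n m (raw n m ℓ u) w

steps : (n m : ℕ) → Config m → List (Letter m) → List (Config m × Letter m)
steps n m u []      = []
steps n m u (ℓ ∷ w) = (u , ℓ) ∷ steps n m (raw n m ℓ u) w

IsZero : ∀ {m} → Config m → Set
IsZero u = ∀ j → u j ≡ 0ℤ

PathToZero : (n m : ℕ) → Config m → List (Letter m) → Set
PathToZero n m v w = ValidWord n m v w × IsZero (run n m v w)

InnerWall : ∀ {m} → List (Letter m) → Fin (suc m) → Set
InnerWall w p = ∀ d → (d , p) ∉ w

-- possible wall positions: -1, 0..m, m+1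
data WallPos (m : ℕ) : Set where
  left-end  : WallPos m
  inner     : Fin (suc m) → WallPos m
  right-end : WallPos m

IsWall : ∀ {m} → List (Letter m) → WallPos m → Set
IsWall w left-end      = (L , fzero) ∉ w
IsWall w (inner p)     = InnerWall w p
IsWall {m} w right-end = (R , fromℕ m) ∉ w

PivotPath : (n m : ℕ) → Config m → List (Letter m) → Set
PivotPath n m v w =
  Σ (WallPos m) λ p →
    IsWall w p × PathToZero n m v w ×
    (∀ w' → PathToZero n m v w' → IsWall w' p → length w ℕ.≤ length w')

IsInnerWallℤ : ∀ {m} → List (Letter m) → ℤ → Set
IsInnerWallℤ {m} w x = Σ (Fin (suc m)) λ p → (+ toℕ p ≡ x) × InnerWall w p

-- [a+1, b] is a P-interval: a, b are consecutive in
-- -1 < p_1 < … < p_t < m+1 (p_i the inner walls)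
PInterval : ∀ {m} → List (Letter m) → ℤ → ℤ → Set
PInterval {m} w a b =
  (a ≡ -1ℤ ⊎ IsInnerWallℤ w a) × (b ≡ + suc m ⊎ IsInnerWallℤ w b) × (a < b) ×
  (∀ p → InnerWall w p → ¬ ((a < + toℕ p) × (+ toℕ p < b)))

ShiftsIn : ∀ {m} → Dir → List (Letter m) → ℤ → ℤ → Set
ShiftsIn {m} d w a b =
  ∀ d' (k : Fin (suc m)) → (d' , k) ∈ w →
    a + 1ℤ ≤ + toℕ k → + toℕ k + 1ℤ ≤ b → d' ≡ d

NoLeftUnitShiftFromEmptyRight : (n m : ℕ) → Config m → List (Letter m) → Set
NoLeftUnitShiftFromEmptyRight n m v w =
  All (λ { (x , ℓ) → ¬ ((ℓ ≡ (L , fromℕ m)) × (x (fromℕ (suc m)) ≡ 0ℤ)) })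
      (steps n m v w)

NoRightUnitShiftFromEmptyLeft : (n m : ℕ) → Config m → List (Letter m) → Set
NoRightUnitShiftFromEmptyLeft n m v w =
  All (λ { (x , ℓ) → ¬ ((ℓ ≡ (R , fzero)) × (x fzero ≡ 0ℤ)) })
      (steps n m v w)

module Submission where

open import Defs
open import Data.Nat as ℕ using (ℕ; zero; suc; _≡ᵇ_; _≤ᵇ_; z≤n; s≤s; _∸_) renaming (_≤_ to _≤ℕ_)
import Data.Nat.Properties as ℕP
import Data.Nat.Divisibility as ℕDiv
open import Data.Nat.DivMod using (m<n⇒m%n≡m)
open import Data.Integer as ℤ using (ℤ; +_; 0ℤ; 1ℤ; -1ℤ; _+_; _-_; -_; _≤_; _<_; +≤+; +<+)
import Data.Integer.Properties as ℤP
open import Data.Integer.DivMod using (_%ℕ_; _/ℕ_; n%ℕd<d; a≡a%ℕn+[a/ℕn]*n)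
open import Data.Integer.Divisibility.Signed as ℤDiv using (divides) renaming (_∣_ to _∣ₛ_)
open import Data.Integer.Tactic.RingSolver using (solve-∀)
open import Data.Fin using (Fin; toℕ; fromℕ; fromℕ<; inject₁; opposite) renaming (zero to fzero; suc to fsuc)
import Data.Fin.Properties as FinP
open import Data.Bool using (Bool; true; false; if_then_else_; T)
open import Data.Bool.Properties using (T-∨; if-eta; if-float)
open import Data.Unit using (tt)
open import Data.Empty using (⊥-elim)
open import Data.List using (List; []; _∷_; length; map)
import Data.Integer.Divisibility as ℤDivᵤ
open import Data.List.Membership.Propositional using (_∈_)
open import Data.List.Relation.Unary.All as All using (All; []; _∷_)
open import Data.List.Relation.Unary.Any using (Any; here; there)
open import Data.List.Relation.Unary.All.Properties using (¬Any⇒All¬; map⁺)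
open import Data.List.Properties using (length-map)
open import Data.Product using (Σ; _×_; _,_; proj₁; proj₂)
open import Data.Sum using (_⊎_; inj₁; inj₂)
open import Function.Bundles using (Equivalence)
open import Relation.Binary.PropositionalEquality
open import Relation.Nullary using (¬_; yes; no)
open import Relation.Nullary.Decidable using (T?)
open import Relation.Binary.Definitions using (tri<; tri≈; tri>)

-- Everything is proved for an arbitrary modulus N ≥ 1.
--
-- Part (1) rests on the potential F_t(x) = Σ_{i>t} x_i.  If all letters right
-- of the boundary t shift left, each ←s_t lowers F_t by one and every other
-- letter leaves it unchanged, except that ←s_m wraps the last entry around
-- mod N, raising F_t by N when that entry was 0 (a bad step).  Hence a path
-- from v to 0 containing a bad step uses at least F_t(v) + N ≥ N letters s_t.
-- If the interval starts after an inner wall t, no s_t occurs at all.  If there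
-- are no inner walls, the path uses left shifts only and is shortest among such
-- paths, yet deleting the first N occurrences of every letter (module Surgery)
-- yields a shorter one.  Part (2) is part (1) for the mirror image (module Mirror).

if-T : ∀ {A : Set} {b : Bool} {x y : A} → T b → (if b then x else y) ≡ x
if-T {b = true} _ = refl

if-F : ∀ {A : Set} {b : Bool} {x y : A} → ¬ T b → (if b then x else y) ≡ y
if-F {b = false} _ = refl
if-F {b = true} p = ⊥-elim (p tt)

if-≡ᵇ-yes : ∀ {A : Set} {a c : ℕ} {x y : A} → a ≡ c → (if a ≡ᵇ c then x else y) ≡ x
if-≡ᵇ-yes e = if-T (ℕP.≡⇒≡ᵇ _ _ e)

if-≡ᵇ-no : ∀ {A : Set} {a c : ℕ} {x y : A} → a ≢ c → (if a ≡ᵇ c then x else y) ≡ y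
if-≡ᵇ-no e = if-F (λ b → e (ℕP.≡ᵇ⇒≡ _ _ b))

if-≤ᵇ-yes : ∀ {A : Set} {a c : ℕ} {x y : A} → a ℕ.≤ c → (if a ≤ᵇ c then x else y) ≡ x
if-≤ᵇ-yes le = if-T (ℕP.≤⇒≤ᵇ le)

if-≤ᵇ-no : ∀ {A : Set} {a c : ℕ} {x y : A} → c ℕ.< a → (if a ≤ᵇ c then x else y) ≡ y
if-≤ᵇ-no lt = if-F (λ b → ℕP.<⇒≱ lt (ℕP.≤ᵇ⇒≤ _ _ b))

sum-cong : ∀ {k} {f g : Fin k → ℤ} → (∀ i → f i ≡ g i) → sumℤ f ≡ sumℤ g
sum-cong {zero} h = refl
sum-cong {suc k} h = cong₂ _+_ (h fzero) (sum-cong (λ i → h (fsuc i)))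

sum-+ : ∀ {k} (f g : Fin k → ℤ) → sumℤ (λ i → f i + g i) ≡ sumℤ f + sumℤ g
sum-+ {zero} f g = refl
sum-+ {suc k} f g = begin
    (f fzero + g fzero) + sumℤ (λ i → f (fsuc i) + g (fsuc i))
  ≡⟨ cong (_+_ (f fzero + g fzero)) (sum-+ (λ i → f (fsuc i)) (λ i → g (fsuc i))) ⟩
    (f fzero + g fzero) + (sumℤ (λ i → f (fsuc i)) + sumℤ (λ i → g (fsuc i)))
  ≡⟨ interchange (f fzero) (g fzero) _ _ ⟩
    (f fzero + sumℤ (λ i → f (fsuc i))) + (g fzero + sumℤ (λ i → g (fsuc i))) ∎
  where
  open ≡-Reasoning
  interchange : ∀ (a b c d : ℤ) → (a + b) + (c + d) ≡ (a + c) + (b + d)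
  interchange = solve-∀

sum-zero : ∀ {k} {f : Fin k → ℤ} → (∀ i → f i ≡ 0ℤ) → sumℤ f ≡ 0ℤ
sum-zero {zero} h = refl
sum-zero {suc k} h = cong₂ _+_ (h fzero) (sum-zero (λ i → h (fsuc i)))

point : ∀ {k} → ℕ → ℤ → Fin k → ℤ
point t c i = if toℕ i ≡ᵇ t then c else 0ℤ

sum-point : ∀ {k} t c → t ℕ.< k → sumℤ {k} (point t c) ≡ c
sum-point {suc k} zero c _ =
  trans (cong (_+_ c) (sum-zero {k} (λ _ → refl))) (ℤP.+-identityʳ c)
sum-point {suc k} (suc t) c (s≤s t<k) = trans (ℤP.+-identityˡ _) (sum-point t c t<k)

divides-zero : ∀ d → d ∣ₛ 0ℤ
divides-zero d = divides 0ℤ (sym (ℤP.*-zeroˡ d))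

sum-divisible : ∀ {k} d (f : Fin k → ℤ) → (∀ i → d ∣ₛ f i) → d ∣ₛ sumℤ f
sum-divisible {zero} d f h = divides-zero d
sum-divisible {suc k} d f h =
  ℤDiv.∣m∣n⇒∣m+n (h fzero) (sum-divisible d (λ i → f (fsuc i)) (λ i → h (fsuc i)))

sum-last : ∀ {k} (f : Fin (suc k) → ℤ) → sumℤ f ≡ sumℤ (λ i → f (inject₁ i)) + f (fromℕ k)
sum-last {zero} f = ℤP.+-comm (f fzero) 0ℤ
sum-last {suc k} f =
  trans (cong (_+_ (f fzero)) (sum-last (λ i → f (fsuc i))))
        (sym (ℤP.+-assoc (f fzero) _ (f (fsuc (fromℕ k)))))

sum-opposite : ∀ {k} (f : Fin k → ℤ) → sumℤ (λ i → f (opposite i)) ≡ sumℤ f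
sum-opposite {zero} f = refl
sum-opposite {suc k} f = begin
    f (fromℕ k) + sumℤ (λ i → f (opposite (fsuc i)))
  ≡⟨ cong (_+_ (f (fromℕ k))) (sum-opposite (λ i → f (inject₁ i))) ⟩
    f (fromℕ k) + sumℤ (λ i → f (inject₁ i))
  ≡⟨ ℤP.+-comm (f (fromℕ k)) _ ⟩
    sumℤ (λ i → f (inject₁ i)) + f (fromℕ k)
  ≡⟨ sum-last f ⟨
    sumℤ f ∎
  where open ≡-Reasoning

-- Reduction modulo N = k + 1

module Modulus (k : ℕ) where

  N : ℕ
  N = suc k

  reduce-nonneg : ∀ z → 0ℤ ≤ reduce N z
  reduce-nonneg z = +≤+ z≤n

  reduce-< : ∀ z → reduce N z < + N
  reduce-< z = +<+ (n%ℕd<d z N)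

  reduce-id : ∀ a → a ℕ.< N → reduce N (+ a) ≡ + a
  reduce-id a a<N = cong +_ (m<n⇒m%n≡m a<N)

  reduce-divides : ∀ z → (+ N) ∣ₛ (reduce N z - z)
  reduce-divides z = divides (- (z /ℕ N)) (begin
      + (z %ℕ N) - z
    ≡⟨ cong (λ u → + (z %ℕ N) - u) (a≡a%ℕn+[a/ℕn]*n z N) ⟩
      + (z %ℕ N) - (+ (z %ℕ N) + (z /ℕ N) ℤ.* + N)
    ≡⟨ cancel (+ (z %ℕ N)) (z /ℕ N) (+ N) ⟩
      - (z /ℕ N) ℤ.* + N ∎)
    where
    open ≡-Reasoning
    cancel : ∀ (r q d : ℤ) → r - (r + q ℤ.* d) ≡ (- q) ℤ.* d
    cancel = solve-∀

  wrap-from-zero : reduce N (0ℤ + -1ℤ) - (0ℤ + -1ℤ) ≡ + N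
  wrap-from-zero = from-zero k
    where
    from-zero : ∀ a → reduce (suc a) (0ℤ + -1ℤ) - (0ℤ + -1ℤ) ≡ + suc a
    from-zero zero = refl
    from-zero (suc a) = cong +_ (ℕP.+-comm (suc a) 1)

  wrap-nonneg : ∀ z → 0ℤ ≤ z → z < + N → 0ℤ ≤ reduce N (z + -1ℤ) - (z + -1ℤ)
  wrap-nonneg (+ zero) _ _ = ℤP.≤-trans (+≤+ z≤n) (ℤP.≤-reflexive (sym wrap-from-zero))
  wrap-nonneg (+ suc a) _ (+<+ a<N) =
    ℤP.≤-reflexive (sym (trans (cong (_- + a) (reduce-id a (ℕP.<-trans (ℕP.n<1+n a) a<N))) (ℤP.+-inverseʳ (+ a))))

  residue-zero : ∀ z → 0ℤ ≤ z → z < + N → (+ N) ∣ₛ z → z ≡ 0ℤ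
  residue-zero (+ zero) _ _ _ = refl
  residue-zero (+ suc a) _ (+<+ a<N) N∣z = ⊥-elim (ℕDiv.>⇒∤ a<N (ℤDiv.∣⇒∣ᵤ N∣z))

-- Single steps in Z_{N,m}: a letter shifts a unit between neighbouring
-- entries; only at the two end entries can the result wrap around mod N.

module Step (k m : ℕ) where
  open Modulus k public

  step : Letter m → Config m → Config m
  step = raw N m

  Vertex : Config m → Set
  Vertex = IsVertex N m

  lst : Fin (suc (suc m))
  lst = fromℕ (suc m)

  toℕ-lst : toℕ lst ≡ suc m
  toℕ-lst = FinP.toℕ-fromℕ (suc m)

  index≤m : ∀ (i : Fin (suc m)) → toℕ i ℕ.≤ m
  index≤m i = ℕP.≤-pred (FinP.toℕ<n i)

  first-is-end : ∀ (j : Fin (suc (suc m))) → toℕ j ≡ 0 → IsEnd j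
  first-is-end j e rewrite e = tt

  last-is-end : ∀ (j : Fin (suc (suc m))) → toℕ j ≡ suc m → IsEnd j
  last-is-end j e rewrite e = ℕP.≡⇒≡ᵇ m m refl

  end-cases : ∀ (j : Fin (suc (suc m))) → IsEnd j → toℕ j ≡ 0 ⊎ toℕ j ≡ suc m
  end-cases j en with T-∨ {toℕ j ≡ᵇ 0} {toℕ j ≡ᵇ suc m} .Equivalence.to en
  ... | inj₁ b = inj₁ (ℕP.≡ᵇ⇒≡ (toℕ j) 0 b)
  ... | inj₂ b = inj₂ (ℕP.≡ᵇ⇒≡ (toℕ j) (suc m) b)

  inner-bounds : ∀ (j : Fin (suc (suc m))) → ¬ IsEnd j → 1 ℕ.≤ toℕ j × toℕ j ℕ.≤ m
  inner-bounds j ne =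
    ℕP.n≢0⇒n>0 (λ e → ne (first-is-end j e)) ,
    ℕP.≤-pred (ℕP.≤∧≢⇒< (ℕP.≤-pred (FinP.toℕ<n j)) (λ e → ne (last-is-end j e)))

  adjust-end : ∀ j c z → IsEnd j → adjust N m j c z ≡ reduce N (z + c)
  adjust-end j c z = if-T

  adjust-inner : ∀ j c z → ¬ IsEnd j → adjust N m j c z ≡ z + c
  adjust-inner j c z = if-F

  i≢1+i : ∀ {a i : ℕ} → a ≡ i → a ≢ suc i
  i≢1+i refl e = ℕP.1+n≢n (sym e)

  step-at : ∀ d i x j → toℕ j ≡ toℕ i → step (d , i) x j ≡ adjust N m j (δ d) (x j)
  step-at d i x j = if-≡ᵇ-yes

  step-after : ∀ d i x j → toℕ j ≡ suc (toℕ i) → step (d , i) x j ≡ adjust N m j (- δ d) (x j)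
  step-after d i x j e = trans (if-≡ᵇ-no (λ e' → i≢1+i e' e)) (if-≡ᵇ-yes e)

  step-away : ∀ d i x j → toℕ j ≢ toℕ i → toℕ j ≢ suc (toℕ i) → step (d , i) x j ≡ x j
  step-away d i x j e e' = trans (if-≡ᵇ-no e) (if-≡ᵇ-no e')

  shift : Letter m → Fin (suc (suc m)) → ℤ
  shift (d , i) j = point (toℕ i) (δ d) j + point (suc (toℕ i)) (- δ d) j

  shift-at : ∀ d i j → toℕ j ≡ toℕ i → shift (d , i) j ≡ δ d
  shift-at d i j e = trans (cong₂ _+_ (if-≡ᵇ-yes e) (if-≡ᵇ-no (i≢1+i e))) (ℤP.+-identityʳ _)

  shift-after : ∀ d i j → toℕ j ≡ suc (toℕ i) → shift (d , i) j ≡ - δ d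
  shift-after d i j e = trans (cong₂ _+_ (if-≡ᵇ-no (λ e' → i≢1+i e' e)) (if-≡ᵇ-yes e)) (ℤP.+-identityˡ _)

  shift-away : ∀ d i j → toℕ j ≢ toℕ i → toℕ j ≢ suc (toℕ i) → shift (d , i) j ≡ 0ℤ
  shift-away d i j e e' = cong₂ _+_ (if-≡ᵇ-no e) (if-≡ᵇ-no e')

  sum-shift : ∀ ℓ → sumℤ (shift ℓ) ≡ 0ℤ
  sum-shift (d , i) = begin
      sumℤ (shift (d , i))
    ≡⟨ sum-+ {suc (suc m)} (point (toℕ i) (δ d)) (point (suc (toℕ i)) (- δ d)) ⟩
      sumℤ (point {suc (suc m)} (toℕ i) (δ d)) + sumℤ (point {suc (suc m)} (suc (toℕ i)) (- δ d))
    ≡⟨ cong₂ _+_ (sum-point (toℕ i) (δ d) (s≤s (ℕP.m≤n⇒m≤1+n (index≤m i))))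
                 (sum-point (suc (toℕ i)) (- δ d) (s≤s (s≤s (index≤m i)))) ⟩
      δ d - δ d
    ≡⟨ ℤP.+-inverseʳ (δ d) ⟩
      0ℤ ∎
    where open ≡-Reasoning

  step-coordinate : ∀ ℓ x j →
    step ℓ x j ≡ adjust N m j (shift ℓ j) (x j) ⊎ (step ℓ x j ≡ x j × shift ℓ j ≡ 0ℤ)
  step-coordinate (d , i) x j with toℕ j ℕ.≟ toℕ i | toℕ j ℕ.≟ suc (toℕ i)
  ... | yes e | _ =
    inj₁ (trans (step-at d i x j e) (cong (λ c → adjust N m j c (x j)) (sym (shift-at d i j e))))
  ... | no _ | yes e =
    inj₁ (trans (step-after d i x j e) (cong (λ c → adjust N m j c (x j)) (sym (shift-after d i j e))))
  ... | no e | no e' = inj₂ (step-away d i x j e e' , shift-away d i j e e')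

  step-inner : ∀ ℓ x j → ¬ IsEnd j → step ℓ x j ≡ x j + shift ℓ j
  step-inner ℓ x j ne with step-coordinate ℓ x j
  ... | inj₁ e = trans e (adjust-inner j (shift ℓ j) (x j) ne)
  ... | inj₂ (e , s0) = trans e (sym (trans (cong (_+_ (x j)) s0) (ℤP.+-identityʳ (x j))))

  wrap : Letter m → Config m → Fin (suc (suc m)) → ℤ
  wrap ℓ x j = step ℓ x j - (x j + shift ℓ j)

  step-decomposition : ∀ ℓ x j → step ℓ x j ≡ (x j + shift ℓ j) + wrap ℓ x j
  step-decomposition ℓ x j = split (step ℓ x j) (x j + shift ℓ j)
    where
    split : ∀ (a b : ℤ) → a ≡ b + (a - b)
    split = solve-∀

  wrap-inner : ∀ ℓ x j → ¬ IsEnd j → wrap ℓ x j ≡ 0ℤ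
  wrap-inner ℓ x j ne = trans (cong (_- (x j + shift ℓ j)) (step-inner ℓ x j ne)) (ℤP.+-inverseʳ (x j + shift ℓ j))

  wrap-divisible : ∀ ℓ x j → (+ N) ∣ₛ wrap ℓ x j
  wrap-divisible ℓ x j with T? (isEndᵇ j)
  ... | no ne = subst ((+ N) ∣ₛ_) (sym (wrap-inner ℓ x j ne)) (divides-zero _)
  ... | yes en with step-coordinate ℓ x j
  ...   | inj₁ e = subst ((+ N) ∣ₛ_) (sym (cong (_- (x j + shift ℓ j)) (trans e (adjust-end j (shift ℓ j) (x j) en))))
                         (reduce-divides (x j + shift ℓ j))
  ...   | inj₂ (e , s0) = subst ((+ N) ∣ₛ_) (sym (trans (cong₂ (λ a b → a - (x j + b)) e s0) vanish))
                                (divides-zero _)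
    where
    vanish : x j - (x j + 0ℤ) ≡ 0ℤ
    vanish = trans (cong (λ b → x j - b) (ℤP.+-identityʳ (x j))) (ℤP.+-inverseʳ (x j))

  -- A step from a vertex is again a vertex as soon as its inner entries stay
  -- in {-1,0,1}: end entries are reduced, and the total changes by a multiple of N.
  step-vertex : ∀ ℓ x → Vertex x →
    (∀ j → ¬ IsEnd j → (-1ℤ ≤ step ℓ x j) × (step ℓ x j ≤ 1ℤ)) → Vertex (step ℓ x)
  step-vertex ℓ x vx inner-ok = record
    { end-range = end-ok
    ; inner-range = inner-ok
    ; sum-zero = ℤDiv.∣⇒∣ᵤ (subst ((+ N) ∣ₛ_) (sym total) total-divisible) }
    where
    end-ok : ∀ j → IsEnd j → (0ℤ ≤ step ℓ x j) × (step ℓ x j < + N)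
    end-ok j en with step-coordinate ℓ x j
    ... | inj₁ e rewrite e | adjust-end j (shift ℓ j) (x j) en =
      reduce-nonneg (x j + shift ℓ j) , reduce-< (x j + shift ℓ j)
    ... | inj₂ (e , _) rewrite e = IsVertex.end-range vx j en
    total : sumℤ (step ℓ x) ≡ (sumℤ x + sumℤ (shift ℓ)) + sumℤ (wrap ℓ x)
    total = trans (sum-cong (step-decomposition ℓ x))
      (trans (sum-+ (λ j → x j + shift ℓ j) (wrap ℓ x)) (cong (_+ sumℤ (wrap ℓ x)) (sum-+ x (shift ℓ))))
    total-divisible : (+ N) ∣ₛ ((sumℤ x + sumℤ (shift ℓ)) + sumℤ (wrap ℓ x))
    total-divisible = ℤDiv.∣m∣n⇒∣m+n
      (subst ((+ N) ∣ₛ_) (sym (trans (cong (_+_ (sumℤ x)) (sum-shift ℓ)) (ℤP.+-identityʳ (sumℤ x))))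
             (ℤDiv.∣ᵤ⇒∣ (IsVertex.sum-zero vx)))
      (sum-divisible (+ N) (wrap ℓ x) (wrap-divisible ℓ x))

  run-vertex : ∀ x w → Vertex x → ValidWord N m x w → Vertex (run N m x w)
  run-vertex x [] vx _ = vx
  run-vertex x (ℓ ∷ w) _ (vx' , vw) = run-vertex (step ℓ x) w vx' vw

-- The potential F_t(x) = Σ_{i>t} x_i.  A letter s_i with i ≠ t leaves it
-- unchanged up to wrap-around at the last entry, ←s_t lowers it by one, and
-- the wrap-around of a left shift at the last entry raises it by N exactly
-- when that entry is 0.  Summed along a path this bounds the number of
-- letters s_t by the drop of F_t, plus N for every bad step.

module Potential (k m : ℕ) where
  open Step k m public

  above : ℕ → (Fin (suc (suc m)) → ℤ) → Fin (suc (suc m)) → ℤ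
  above t f i = if suc t ≤ᵇ toℕ i then f i else 0ℤ

  F : ℕ → Config m → ℤ
  F t x = sumFrom (suc t) x

  F-zero : ∀ t x → IsZero x → F t x ≡ 0ℤ
  F-zero t x x≡0 = sum-zero (λ i → trans (cong (λ u → if suc t ≤ᵇ toℕ i then u else 0ℤ) (x≡0 i)) (if-eta _))

  gain : ℕ → Letter m → ℤ
  gain t (d , i) = (if suc t ≤ᵇ toℕ i then δ d else 0ℤ) + (if suc t ≤ᵇ suc (toℕ i) then - δ d else 0ℤ)

  above-point : ∀ t s c j → above t (point s c) j ≡ point s (if suc t ≤ᵇ s then c else 0ℤ) j
  above-point t s c j with toℕ j ℕ.≟ s
  ... | yes refl = trans (cong (λ u → if suc t ≤ᵇ toℕ j then u else 0ℤ) (if-≡ᵇ-yes {a = toℕ j} refl))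
                         (sym (if-≡ᵇ-yes {a = toℕ j} refl))
  ... | no e = trans (cong (λ u → if suc t ≤ᵇ toℕ j then u else 0ℤ) (if-≡ᵇ-no e))
                     (trans (if-eta _) (sym (if-≡ᵇ-no e)))

  above-+ : ∀ t (f g : Fin (suc (suc m)) → ℤ) j → above t (λ i → f i + g i) j ≡ above t f j + above t g j
  above-+ t f g j with suc t ≤ᵇ toℕ j
  ... | true = refl
  ... | false = refl

  sum-above-shift : ∀ t ℓ → sumℤ (above t (shift ℓ)) ≡ gain t ℓ
  sum-above-shift t (d , i) = begin
      sumℤ (above t (shift (d , i)))
    ≡⟨ sum-cong split ⟩
      sumℤ {suc (suc m)} (λ j → point (toℕ i) gᵢ j + point (suc (toℕ i)) gᵢ₊₁ j)
    ≡⟨ sum-+ {suc (suc m)} (point (toℕ i) gᵢ) (point (suc (toℕ i)) gᵢ₊₁) ⟩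
      sumℤ (point {suc (suc m)} (toℕ i) gᵢ) + sumℤ (point {suc (suc m)} (suc (toℕ i)) gᵢ₊₁)
    ≡⟨ cong₂ _+_ (sum-point (toℕ i) gᵢ (s≤s (ℕP.m≤n⇒m≤1+n (index≤m i))))
                 (sum-point (suc (toℕ i)) gᵢ₊₁ (s≤s (s≤s (index≤m i)))) ⟩
      gain t (d , i) ∎
    where
    open ≡-Reasoning
    gᵢ gᵢ₊₁ : ℤ
    gᵢ = if suc t ≤ᵇ toℕ i then δ d else 0ℤ
    gᵢ₊₁ = if suc t ≤ᵇ suc (toℕ i) then - δ d else 0ℤ
    split : ∀ j → above t (shift (d , i)) j ≡ point (toℕ i) gᵢ j + point (suc (toℕ i)) gᵢ₊₁ j
    split j = trans (above-+ t (point (toℕ i) (δ d)) (point (suc (toℕ i)) (- δ d)) j)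
                    (cong₂ _+_ (above-point t (toℕ i) (δ d) j) (above-point t (suc (toℕ i)) (- δ d) j))

  -- below the last entry the wrap-around vanishes or is cut off by the mask
  above-wrap : ∀ t → t ℕ.≤ m → ∀ ℓ x j → above t (wrap ℓ x) j ≡ point (suc m) (wrap ℓ x lst) j
  above-wrap t t≤m ℓ x j with toℕ j ℕ.≟ suc m | T? (isEndᵇ j)
  ... | yes e | _ =
    trans (if-≤ᵇ-yes (subst (suc t ℕ.≤_) (sym e) (s≤s t≤m)))
          (trans (cong (wrap ℓ x) (FinP.toℕ-injective (trans e (sym toℕ-lst)))) (sym (if-≡ᵇ-yes e)))
  ... | no e | no ne = trans (cong (λ u → if suc t ≤ᵇ toℕ j then u else 0ℤ) (wrap-inner ℓ x j ne))
                                (trans (if-eta _) (sym (if-≡ᵇ-no e)))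
  ... | no e | yes en with end-cases j en
  ...   | inj₂ j≡last = ⊥-elim (e j≡last)
  ...   | inj₁ j≡0 = trans (if-≤ᵇ-no {c = toℕ j} (subst (ℕ._< suc t) (sym j≡0) (s≤s z≤n))) (sym (if-≡ᵇ-no e))

  potential-change : ∀ t → t ℕ.≤ m → ∀ ℓ x → F t (step ℓ x) ≡ (F t x + gain t ℓ) + wrap ℓ x lst
  potential-change t t≤m ℓ x = begin
      sumℤ (above t (step ℓ x))
    ≡⟨ sum-cong (λ j → trans (cong (λ u → if suc t ≤ᵇ toℕ j then u else 0ℤ) (step-decomposition ℓ x j))
                             (above-+ t (λ i → x i + shift ℓ i) (wrap ℓ x) j)) ⟩
      sumℤ (λ j → above t (λ i → x i + shift ℓ i) j + above t (wrap ℓ x) j)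
    ≡⟨ sum-+ (above t (λ i → x i + shift ℓ i)) (above t (wrap ℓ x)) ⟩
      sumℤ (above t (λ i → x i + shift ℓ i)) + sumℤ (above t (wrap ℓ x))
    ≡⟨ cong₂ _+_ (trans (sum-cong (above-+ t x (shift ℓ))) (sum-+ (above t x) (above t (shift ℓ))))
                 (trans (sum-cong (above-wrap t t≤m ℓ x)) (sum-point (suc m) (wrap ℓ x lst) (ℕP.n<1+n (suc m)))) ⟩
      (F t x + sumℤ (above t (shift ℓ))) + wrap ℓ x lst
    ≡⟨ cong (λ g → (F t x + g) + wrap ℓ x lst) (sum-above-shift t ℓ) ⟩
      (F t x + gain t ℓ) + wrap ℓ x lst ∎
    where open ≡-Reasoning

  crosses : ℕ → Letter m → ℕ
  crosses t (d , i) = if t ≡ᵇ toℕ i then 1 else 0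

  crossings : ℕ → List (Letter m) → ℕ
  crossings t [] = 0
  crossings t (ℓ ∷ w) = crosses t ℓ ℕ.+ crossings t w

  crossings-none : ∀ t w → All (λ ℓ → t ≢ toℕ (proj₂ ℓ)) w → crossings t w ≡ 0
  crossings-none t [] [] = refl
  crossings-none t ((d , i) ∷ w) (t≢i ∷ rest) rewrite if-≡ᵇ-no {x = 1} {y = 0} t≢i = crossings-none t w rest

  Admissible : ℕ → Letter m → Set
  Admissible t (d , i) = toℕ i ℕ.< t ⊎ d ≡ L

  gain-crosses : ∀ t ℓ → Admissible t ℓ → gain t ℓ + + crosses t ℓ ≡ 0ℤ
  gain-crosses t (d , i) adm with ℕP.<-cmp (toℕ i) t | adm
  ... | tri< i<t _ _ | _ = cong₂ _+_
          (cong₂ _+_ (if-≤ᵇ-no (ℕP.m<n⇒m<1+n i<t)) (if-≤ᵇ-no (s≤s i<t)))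
          (cong +_ (if-≡ᵇ-no (λ t≡i → ℕP.<⇒≢ i<t (sym t≡i))))
  ... | tri≈ _ i≡t _ | inj₁ i<t = ⊥-elim (ℕP.<⇒≢ i<t i≡t)
  ... | tri≈ _ i≡t _ | inj₂ refl = cong₂ _+_
          (cong₂ _+_ (if-≤ᵇ-no (s≤s (ℕP.≤-reflexive i≡t))) (if-≤ᵇ-yes (s≤s (ℕP.≤-reflexive (sym i≡t)))))
          (cong +_ (if-≡ᵇ-yes (sym i≡t)))
  ... | tri> _ _ t<i | inj₁ i<t = ⊥-elim (ℕP.<-asym i<t t<i)
  ... | tri> _ _ t<i | inj₂ refl = cong₂ _+_
          (cong₂ _+_ (if-≤ᵇ-yes t<i) (if-≤ᵇ-yes (ℕP.m≤n⇒m≤1+n t<i)))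
          (cong +_ (if-≡ᵇ-no (ℕP.<⇒≢ t<i)))

  lst≢index : ∀ (i : Fin (suc m)) → toℕ lst ≢ toℕ i
  lst≢index i e = ℕP.1+n≰n (ℕP.≤-trans (ℕP.≤-reflexive (trans (sym toℕ-lst) e)) (index≤m i))

  wrap-last-away : ∀ d i x → toℕ i ≢ m → wrap (d , i) x lst ≡ 0ℤ
  wrap-last-away d i x i≢m = begin
      step (d , i) x lst - (x lst + shift (d , i) lst)
    ≡⟨ cong₂ (λ a b → a - (x lst + b)) (step-away d i x lst (lst≢index i) lst≢1+i)
                                         (shift-away d i lst (lst≢index i) lst≢1+i) ⟩
      x lst - (x lst + 0ℤ)
    ≡⟨ cong (_-_ (x lst)) (ℤP.+-identityʳ (x lst)) ⟩
      x lst - x lst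
    ≡⟨ ℤP.+-inverseʳ (x lst) ⟩
      0ℤ ∎
    where
    open ≡-Reasoning
    lst≢1+i : toℕ lst ≢ suc (toℕ i)
    lst≢1+i e = i≢m (sym (ℕP.suc-injective (trans (sym toℕ-lst) e)))

  wrap-last-left : ∀ i x → toℕ i ≡ m → wrap (L , i) x lst ≡ reduce N (x lst + -1ℤ) - (x lst + -1ℤ)
  wrap-last-left i x i≡m = cong₂ _-_
    (trans (step-after L i x lst lst≡1+i) (adjust-end lst -1ℤ (x lst) (last-is-end lst toℕ-lst)))
    (cong (_+_ (x lst)) (shift-after L i lst lst≡1+i))
    where
    lst≡1+i : toℕ lst ≡ suc (toℕ i)
    lst≡1+i = trans toℕ-lst (cong suc (sym i≡m))

  wrap-last-nonneg : ∀ t → t ℕ.≤ m → ∀ ℓ x → Vertex x → Admissible t ℓ → 0ℤ ≤ wrap ℓ x lst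
  wrap-last-nonneg t t≤m (d , i) x vx adm with toℕ i ℕ.≟ m | adm
  ... | no i≢m | _ = ℤP.≤-reflexive (sym (wrap-last-away d i x i≢m))
  ... | yes i≡m | inj₁ i<t = ⊥-elim (ℕP.<⇒≱ i<t (ℕP.≤-trans t≤m (ℕP.≤-reflexive (sym i≡m))))
  ... | yes i≡m | inj₂ refl rewrite wrap-last-left i x i≡m =
    wrap-nonneg (x lst) (proj₁ last-range) (proj₂ last-range)
    where
    last-range : (0ℤ ≤ x lst) × (x lst < + N)
    last-range = IsVertex.end-range vx lst (last-is-end lst toℕ-lst)

  LeftFromEmptyRight : Config m × Letter m → Set
  LeftFromEmptyRight (x , ℓ) = (ℓ ≡ (L , fromℕ m)) × (x lst ≡ 0ℤ)

  wrap-last-bad : ∀ ℓ x → LeftFromEmptyRight (x , ℓ) → wrap ℓ x lst ≡ + N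
  wrap-last-bad .(L , fromℕ m) x (refl , x≡0) rewrite wrap-last-left (fromℕ m) x (FinP.toℕ-fromℕ m) | x≡0 =
    wrap-from-zero

  potential-step : ∀ t → t ℕ.≤ m → ∀ ℓ x → Admissible t ℓ →
    F t (step ℓ x) + + crosses t ℓ ≡ F t x + wrap ℓ x lst
  potential-step t t≤m ℓ x adm = begin
      F t (step ℓ x) + + crosses t ℓ
    ≡⟨ cong (_+ + crosses t ℓ) (potential-change t t≤m ℓ x) ⟩
      ((F t x + gain t ℓ) + wrap ℓ x lst) + + crosses t ℓ
    ≡⟨ regroup (F t x) (gain t ℓ) (wrap ℓ x lst) (+ crosses t ℓ) ⟩
      (F t x + wrap ℓ x lst) + (gain t ℓ + + crosses t ℓ)
    ≡⟨ cong (_+_ (F t x + wrap ℓ x lst)) (gain-crosses t ℓ adm) ⟩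
      (F t x + wrap ℓ x lst) + 0ℤ
    ≡⟨ ℤP.+-identityʳ _ ⟩
      F t x + wrap ℓ x lst ∎
    where
    open ≡-Reasoning
    regroup : ∀ (a g w c : ℤ) → ((a + g) + w) + c ≡ (a + w) + (g + c)
    regroup = solve-∀

  -- one step of the telescoping estimate: a step with correction b, of which
  -- at least s - s' is claimed, passes a bound F + s' ≤ … back to F + s ≤ …
  telescope : ∀ {a a' b c e C s s' : ℤ} → a' + c ≡ a + b → s ≤ b + s' → a' + s' ≤ e + C →
    a + s ≤ e + (c + C)
  telescope {a} {a'} {b} {c} {e} {C} {s} {s'} change s≤b+s' rest = begin
      a + s
    ≤⟨ ℤP.+-monoʳ-≤ a s≤b+s' ⟩
      a + (b + s')
    ≡⟨ ℤP.+-assoc a b s' ⟨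
      (a + b) + s'
    ≡⟨ cong (_+ s') change ⟨
      (a' + c) + s'
    ≡⟨ swap a' c s' ⟩
      (a' + s') + c
    ≤⟨ ℤP.+-monoˡ-≤ c rest ⟩
      (e + C) + c
    ≡⟨ swap e C c ⟩
      (e + c) + C
    ≡⟨ ℤP.+-assoc e c C ⟩
      e + (c + C) ∎
    where
    open ℤP.≤-Reasoning
    swap : ∀ (x y z : ℤ) → (x + y) + z ≡ (x + z) + y
    swap = solve-∀

  crossings-cons : ∀ t ℓ w → + crossings t (ℓ ∷ w) ≡ + crosses t ℓ + + crossings t w
  crossings-cons t ℓ w = ℤP.pos-+ (crosses t ℓ) (crossings t w)

  bound-step : ∀ t → t ℕ.≤ m → ∀ ℓ x w {s s'} → Admissible t ℓ → s ≤ wrap ℓ x lst + s' →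
    F t (step ℓ x) + s' ≤ F t (run N m (step ℓ x) w) + + crossings t w →
    F t x + s ≤ F t (run N m x (ℓ ∷ w)) + + crossings t (ℓ ∷ w)
  bound-step t t≤m ℓ x w {s} adm s≤ rest =
    subst (λ c → F t x + s ≤ F t (run N m x (ℓ ∷ w)) + c) (sym (crossings-cons t ℓ w))
      (telescope {a = F t x} {a' = F t (step ℓ x)} {b = wrap ℓ x lst} {c = + crosses t ℓ}
                 {e = F t (run N m (step ℓ x) w)} {C = + crossings t w}
                 (potential-step t t≤m ℓ x adm) s≤ rest)

  potential-bound : ∀ t → t ℕ.≤ m → ∀ x w → Vertex x → ValidWord N m x w → All (Admissible t) w →
    F t x + 0ℤ ≤ F t (run N m x w) + + crossings t w
  potential-bound t t≤m x [] vx _ _ = ℤP.≤-refl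
  potential-bound t t≤m x (ℓ ∷ w) vx (vx' , vw) (adm ∷ adms) =
    bound-step t t≤m ℓ x w adm
      (ℤP.≤-trans (wrap-last-nonneg t t≤m ℓ x vx adm) (ℤP.≤-reflexive (sym (ℤP.+-identityʳ _))))
      (potential-bound t t≤m (step ℓ x) w vx' vw adms)

  potential-jump : ∀ t → t ℕ.≤ m → ∀ x w → Vertex x → ValidWord N m x w → All (Admissible t) w →
    Any LeftFromEmptyRight (steps N m x w) → F t x + + N ≤ F t (run N m x w) + + crossings t w
  potential-jump t t≤m x (ℓ ∷ w) vx (vx' , vw) (adm ∷ adms) (here bad) =
    bound-step t t≤m ℓ x w adm
      (ℤP.≤-reflexive (sym (trans (ℤP.+-identityʳ _) (wrap-last-bad ℓ x bad))))
      (potential-bound t t≤m (step ℓ x) w vx' vw adms)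
  potential-jump t t≤m x (ℓ ∷ w) vx (vx' , vw) (adm ∷ adms) (there bad) =
    bound-step t t≤m ℓ x w adm
      (ℤP.≤-trans (ℤP.≤-reflexive (sym (ℤP.+-identityˡ (+ N))))
                  (ℤP.+-monoˡ-≤ (+ N) (wrap-last-nonneg t t≤m ℓ x vx adm)))
      (potential-jump t t≤m (step ℓ x) w vx' vw adms bad)

  bad-step-forces-crossings : ∀ t → t ℕ.≤ m → ∀ v w → Vertex v → PathToZero N m v w →
    All (Admissible t) w → 0ℤ ≤ F t v → Any LeftFromEmptyRight (steps N m v w) → N ℕ.≤ crossings t w
  bad-step-forces-crossings t t≤m v w vv (vw , ends-at-0) adms F≥0 bad = ℤP.drop‿+≤+ (begin
      + N                                      ≡⟨ ℤP.+-identityˡ (+ N) ⟨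
      0ℤ + + N                                 ≤⟨ ℤP.+-monoˡ-≤ (+ N) F≥0 ⟩
      F t v + + N                              ≤⟨ potential-jump t t≤m v w vv vw adms bad ⟩
      F t (run N m v w) + + crossings t w      ≡⟨ cong (_+ + crossings t w) (F-zero t _ ends-at-0) ⟩
      0ℤ + + crossings t w                     ≡⟨ ℤP.+-identityˡ _ ⟩
      + crossings t w                          ∎)
    where open ℤP.≤-Reasoning

  no-bad-step-behind-wall : ∀ t → t ℕ.≤ m → ∀ v w → Vertex v → PathToZero N m v w →
    All (Admissible t) w → crossings t w ≡ 0 → 0ℤ ≤ F t v → ¬ Any LeftFromEmptyRight (steps N m v w)
  no-bad-step-behind-wall t t≤m v w vv path adms uncrossed F≥0 bad =
    ℕP.n≮0 (subst (N ℕ.≤_) uncrossed (bad-step-forces-crossings t t≤m v w vv path adms F≥0 bad))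

-- Pruning a path of left shifts.  Deleting, from left to right, the first
-- r_t occurrences of each letter ←s_t from a path of left shifts gives again
-- a path: the pruned path runs ahead of the original one by the displacement
-- of the letters still to be deleted, and this keeps its inner entries in
-- {-1,0,1}.  Deleting N of each letter does not change the endpoint mod N.

module Surgery (k m : ℕ) where
  open Potential k m public

  infix 4 _≋_
  _≋_ : Config m → Config m → Set
  x ≋ y = ∀ j → (+ N) ∣ₛ (y j - x j) × (¬ IsEnd j → x j ≡ y j)

  ≡⇒≋ : ∀ {x y} → (∀ j → x j ≡ y j) → x ≋ y
  ≡⇒≋ {x} {y} x≡y j =
    subst (λ u → (+ N) ∣ₛ (y j - u)) (sym (x≡y j)) (subst ((+ N) ∣ₛ_) (sym (ℤP.+-inverseʳ (y j))) (divides-zero _)) ,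
    λ _ → x≡y j

  ≋-trans : ∀ {x y z} → x ≋ y → y ≋ z → x ≋ z
  ≋-trans {x} {y} {z} x≋y y≋z j =
    subst ((+ N) ∣ₛ_) (telescoping (z j) (y j) (x j)) (ℤDiv.∣m∣n⇒∣m+n (proj₁ (y≋z j)) (proj₁ (x≋y j))) ,
    λ ne → trans (proj₂ (x≋y j) ne) (proj₂ (y≋z j) ne)
    where
    telescoping : ∀ (c b a : ℤ) → (c - b) + (b - a) ≡ c - a
    telescoping = solve-∀

  ≋-sym : ∀ {x y} → x ≋ y → y ≋ x
  ≋-sym {x} {y} x≋y j =
    subst ((+ N) ∣ₛ_) (negate (y j) (x j)) (ℤDiv.∣m⇒∣-m (proj₁ (x≋y j))) ,
    λ ne → sym (proj₂ (x≋y j) ne)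
    where
    negate : ∀ (b a : ℤ) → - (b - a) ≡ a - b
    negate = solve-∀

  ≋-+ : ∀ {x y} (c : Config m) → x ≋ y → (λ j → x j + c j) ≋ (λ j → y j + c j)
  ≋-+ {x} {y} c x≋y j =
    subst ((+ N) ∣ₛ_) (sym (cancel (y j) (x j) (c j))) (proj₁ (x≋y j)) ,
    λ ne → cong (_+ c j) (proj₂ (x≋y j) ne)
    where
    cancel : ∀ (b a e : ℤ) → (b + e) - (a + e) ≡ b - a
    cancel = solve-∀

  shift≋step : ∀ ℓ x → (λ j → x j + shift ℓ j) ≋ step ℓ x
  shift≋step ℓ x j = wrap-divisible ℓ x j , λ ne → sym (step-inner ℓ x j ne)

  ≋-zero : ∀ {x y} → IsZero x → Vertex y → x ≋ y → IsZero y
  ≋-zero {x} {y} x≡0 vy x≋y j with T? (isEndᵇ j)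
  ... | no ne = trans (sym (proj₂ (x≋y j) ne)) (x≡0 j)
  ... | yes en = residue-zero (y j) (proj₁ (IsVertex.end-range vy j en)) (proj₂ (IsVertex.end-range vy j en))
                   (subst ((+ N) ∣ₛ_) (trans (cong (_-_ (y j)) (x≡0 j)) (ℤP.+-identityʳ (y j))) (proj₁ (x≋y j)))

  -- budgets r_t of letters ←s_t still to be deleted
  Budget : Set
  Budget = ℕ → ℕ

  spend : Budget → Letter m → Budget
  spend r ℓ a = r a ∸ crosses a ℓ

  prune : Budget → List (Letter m) → List (Letter m)
  prune r [] = []
  prune r ((d , i) ∷ w) with r (toℕ i)
  ... | zero = (d , i) ∷ prune (spend r (d , i)) w
  ... | suc _ = prune (spend r (d , i)) w

  -- the displacement Σ_t r_t · shift (L , t) of the letters still to be deleted;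
  -- entry a receives r_a (if a ≤ m) and loses r_{a-1} (if a ≥ 1)
  own : Budget → ℕ → ℤ
  own r a = if a ≤ᵇ m then + r a else 0ℤ

  carried : Budget → ℕ → ℤ
  carried r zero = 0ℤ
  carried r (suc b) = + r b

  pending : Budget → Config m
  pending r j = own r (toℕ j) - carried r (toℕ j)

  pending-cong : ∀ {r r'} → (∀ a → r a ≡ r' a) → ∀ j → pending r j ≡ pending r' j
  pending-cong {r} {r'} r≡r' j = cong₂ _-_ (cong (λ u → if toℕ j ≤ᵇ m then + u else 0ℤ) (r≡r' (toℕ j)))
                                           (carried-cong (toℕ j))
    where
    carried-cong : ∀ a → carried r a ≡ carried r' a
    carried-cong zero = refl
    carried-cong (suc b) = cong +_ (r≡r' b)

  indicator : ℕ → ℕ → ℤ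
  indicator a b = if a ≡ᵇ b then 1ℤ else 0ℤ

  spend-left : ∀ r i → 1 ℕ.≤ r (toℕ i) → ∀ a → + spend r (L , i) a ≡ + r a - indicator a (toℕ i)
  spend-left r i r≥1 a with a ℕ.≟ toℕ i
  ... | yes refl rewrite if-≡ᵇ-yes {x = 1} {y = 0} (refl {x = a}) | if-≡ᵇ-yes {x = 1ℤ} {y = 0ℤ} (refl {x = a}) =
    predecessor (r a) r≥1
    where
    predecessor : ∀ n → 1 ℕ.≤ n → + (n ∸ 1) ≡ + n - 1ℤ
    predecessor (suc n) _ = refl
  ... | no a≢i rewrite if-≡ᵇ-no {x = 1} {y = 0} a≢i | if-≡ᵇ-no {x = 1ℤ} {y = 0ℤ} a≢i = sym (ℤP.+-identityʳ _)

  own-spend : ∀ r i → 1 ℕ.≤ r (toℕ i) → ∀ a → own (spend r (L , i)) a ≡ own r a - indicator a (toℕ i)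
  own-spend r i r≥1 a with a ℕ.≤? m
  ... | yes a≤m = trans (if-≤ᵇ-yes a≤m) (trans (spend-left r i r≥1 a) (cong (_- indicator a (toℕ i)) (sym (if-≤ᵇ-yes a≤m))))
  ... | no a≰m = trans (if-≤ᵇ-no (ℕP.≰⇒> a≰m))
      (sym (cong₂ _-_ (if-≤ᵇ-no (ℕP.≰⇒> a≰m)) (if-≡ᵇ-no a≢i)))
    where
    a≢i : a ≢ toℕ i
    a≢i a≡i = a≰m (subst (ℕ._≤ m) (sym a≡i) (index≤m i))

  carried-spend : ∀ r i → 1 ℕ.≤ r (toℕ i) → ∀ a → carried (spend r (L , i)) a ≡ carried r a - indicator a (suc (toℕ i))
  carried-spend r i r≥1 zero = refl
  carried-spend r i r≥1 (suc b) = spend-left r i r≥1 b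

  pending-spend : ∀ r i → 1 ℕ.≤ r (toℕ i) → ∀ j → pending (spend r (L , i)) j ≡ pending r j - shift (L , i) j
  pending-spend r i r≥1 j = begin
      own (spend r (L , i)) a - carried (spend r (L , i)) a
    ≡⟨ cong₂ _-_ (own-spend r i r≥1 a) (carried-spend r i r≥1 a) ⟩
      (own r a - indicator a (toℕ i)) - (carried r a - indicator a (suc (toℕ i)))
    ≡⟨ regroup (own r a) (indicator a (toℕ i)) (carried r a) (indicator a (suc (toℕ i))) ⟩
      pending r j - (indicator a (toℕ i) + - indicator a (suc (toℕ i)))
    ≡⟨ cong (λ u → pending r j - (indicator a (toℕ i) + u)) (if-float -_ (a ≡ᵇ suc (toℕ i))) ⟩
      pending r j - shift (L , i) j ∎
    where
    open ≡-Reasoning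
    a : ℕ
    a = toℕ j
    regroup : ∀ (A p B q : ℤ) → (A - p) - (B - q) ≡ (A - B) - (p + - q)
    regroup = solve-∀

  spend-unused : ∀ r ℓ → r (toℕ (proj₂ ℓ)) ≡ 0 → ∀ a → spend r ℓ a ≡ r a
  spend-unused r (d , i) r≡0 a with a ℕ.≟ toℕ i
  ... | yes refl rewrite r≡0 = ℕP.0∸n≡0 (crosses (toℕ i) (d , i))
  ... | no a≢i = cong (r a ∸_) (if-≡ᵇ-no a≢i)

  pending-unused-at : ∀ r (i : Fin (suc m)) j → r (toℕ i) ≡ 0 → toℕ j ≡ toℕ i → pending r j ≤ 0ℤ
  pending-unused-at r i j r≡0 j≡i = begin
      own r (toℕ j) - carried r (toℕ j)
    ≡⟨ cong (_- carried r (toℕ j)) own≡0 ⟩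
      0ℤ - carried r (toℕ j)
    ≡⟨ ℤP.+-identityˡ _ ⟩
      - carried r (toℕ j)
    ≤⟨ ℤP.neg-mono-≤ (carried-nonneg (toℕ j)) ⟩
      0ℤ ∎
    where
    open ℤP.≤-Reasoning
    own≡0 : own r (toℕ j) ≡ 0ℤ
    own≡0 = trans (cong (λ u → if toℕ j ≤ᵇ m then + u else 0ℤ) (trans (cong r j≡i) r≡0)) (if-eta _)
    carried-nonneg : ∀ a → 0ℤ ≤ carried r a
    carried-nonneg zero = ℤP.≤-refl
    carried-nonneg (suc b) = +≤+ z≤n

  pending-unused-after : ∀ r (i : Fin (suc m)) j → r (toℕ i) ≡ 0 → toℕ j ≡ suc (toℕ i) → 0ℤ ≤ pending r j
  pending-unused-after r i j r≡0 j≡1+i = begin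
      0ℤ                              ≤⟨ own-nonneg (toℕ j) ⟩
      own r (toℕ j)                   ≡⟨ ℤP.+-identityʳ _ ⟨
      own r (toℕ j) - 0ℤ              ≡⟨ cong (_-_ (own r (toℕ j))) carried≡0 ⟨
      own r (toℕ j) - carried r (toℕ j) ∎
    where
    open ℤP.≤-Reasoning
    carried≡0 : carried r (toℕ j) ≡ 0ℤ
    carried≡0 = trans (cong (carried r) j≡1+i) (cong +_ r≡0)
    own-nonneg : ∀ a → 0ℤ ≤ own r a
    own-nonneg a with a ≤ᵇ m
    ... | true = +≤+ z≤n
    ... | false = ℤP.≤-refl

  -- y is the pruned path's vertex, ahead of x by the letters still to be deleted
  Ahead : Config m → Config m → Budget → Set
  Ahead x y r = (λ j → x j + pending r j) ≋ y

  ahead-skip : ∀ x y r i → Ahead x y r → 1 ℕ.≤ r (toℕ i) → Ahead (step (L , i) x) y (spend r (L , i))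
  ahead-skip x y r i ahead r≥1 =
    ≋-trans (≋-+ (pending (spend r (L , i))) (≋-sym (shift≋step (L , i) x)))
            (≋-trans (≡⇒≋ settle) ahead)
    where
    settle : ∀ j → (x j + shift (L , i) j) + pending (spend r (L , i)) j ≡ x j + pending r j
    settle j = trans (cong (_+_ (x j + shift (L , i) j)) (pending-spend r i r≥1 j))
                     (cancel (x j) (shift (L , i) j) (pending r j))
      where
      cancel : ∀ (a s p : ℤ) → (a + s) + (p - s) ≡ a + p
      cancel = solve-∀

  ahead-keep : ∀ x y r ℓ → Ahead x y r → r (toℕ (proj₂ ℓ)) ≡ 0 → Ahead (step ℓ x) (step ℓ y) (spend r ℓ)
  ahead-keep x y r ℓ ahead r≡0 =
    ≋-trans (≡⇒≋ (λ j → cong (_+_ (step ℓ x j)) (pending-cong (spend-unused r ℓ r≡0) j)))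
    (≋-trans (≋-+ (pending r) (≋-sym (shift≋step ℓ x)))
    (≋-trans (≡⇒≋ (λ j → swap (x j) (shift ℓ j) (pending r j)))
    (≋-trans (≋-+ (shift ℓ) ahead)
             (shift≋step ℓ y))))
    where
    swap : ∀ (a s p : ℤ) → (a + s) + p ≡ (a + p) + s
    swap = solve-∀

  ahead-step-inner : ∀ x y r ℓ j → Ahead x y r → ¬ IsEnd j → step ℓ y j ≡ step ℓ x j + pending r j
  ahead-step-inner x y r ℓ j ahead ne = begin
      step ℓ y j                          ≡⟨ step-inner ℓ y j ne ⟩
      y j + shift ℓ j                     ≡⟨ cong (_+ shift ℓ j) (proj₂ (ahead j) ne) ⟨
      (x j + pending r j) + shift ℓ j     ≡⟨ swap (x j) (shift ℓ j) (pending r j) ⟩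
      (x j + shift ℓ j) + pending r j     ≡⟨ cong (_+ pending r j) (step-inner ℓ x j ne) ⟨
      step ℓ x j + pending r j            ∎
    where
    open ≡-Reasoning
    swap : ∀ (a s p : ℤ) → (a + p) + s ≡ (a + s) + p
    swap = solve-∀

  -- keeping a letter whose budget is used up preserves being a vertex: at the
  -- two entries it changes, the pending displacement has the helpful sign
  ahead-vertex : ∀ x y r i → Vertex (step (L , i) x) → Vertex y → Ahead x y r → r (toℕ i) ≡ 0 →
    Vertex (step (L , i) y)
  ahead-vertex x y r i vx' vy ahead r≡0 = step-vertex (L , i) y vy inner-ok
    where
    compare : ∀ j → ¬ IsEnd j → step (L , i) y j ≡ step (L , i) x j + pending r j
    compare j = ahead-step-inner x y r (L , i) j ahead
    inner-ok : ∀ j → ¬ IsEnd j → (-1ℤ ≤ step (L , i) y j) × (step (L , i) y j ≤ 1ℤ)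
    inner-ok j ne with toℕ j ℕ.≟ toℕ i | toℕ j ℕ.≟ suc (toℕ i)
    ... | yes j≡i | _ =
      subst (-1ℤ ≤_) (sym (trans (step-inner (L , i) y j ne) (cong (_+_ (y j)) (shift-at L i j j≡i))))
            (ℤP.≤-trans (proj₁ (IsVertex.inner-range vy j ne)) (ℤP.i≤i+j (y j) 1ℤ)) ,
      subst (_≤ 1ℤ) (sym (compare j ne))
            (ℤP.≤-trans (ℤP.+-monoʳ-≤ (step (L , i) x j) (pending-unused-at r i j r≡0 j≡i))
                        (ℤP.≤-trans (ℤP.≤-reflexive (ℤP.+-identityʳ _)) (proj₂ (IsVertex.inner-range vx' j ne))))
    ... | no _ | yes j≡1+i =
      subst (-1ℤ ≤_) (sym (compare j ne))
            (ℤP.≤-trans (proj₁ (IsVertex.inner-range vx' j ne))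
                        (ℤP.≤-trans (ℤP.≤-reflexive (sym (ℤP.+-identityʳ _)))
                                    (ℤP.+-monoʳ-≤ (step (L , i) x j) (pending-unused-after r i j r≡0 j≡1+i)))) ,
      subst (_≤ 1ℤ) (sym (trans (step-inner (L , i) y j ne) (cong (_+_ (y j)) (shift-after L i j j≡1+i))))
            (ℤP.≤-trans (ℤP.i-j≤i (y j) 1ℤ) (proj₂ (IsVertex.inner-range vy j ne)))
    ... | no j≢i | no j≢1+i rewrite step-away L i y j j≢i j≢1+i = IsVertex.inner-range vy j ne

  ahead-cong : ∀ x {y r r'} → (∀ a → r a ≡ r' a) → Ahead x y r → Ahead x y r'
  ahead-cong x r≡r' ahead = ≋-trans (≡⇒≋ (λ j → cong (_+_ (x j)) (sym (pending-cong r≡r' j)))) ahead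

  budget-after : ∀ r ℓ w a → spend r ℓ a ∸ crossings a w ≡ r a ∸ crossings a (ℓ ∷ w)
  budget-after r ℓ w a = ℕP.∸-+-assoc (r a) (crosses a ℓ) (crossings a w)

  IsLeft : Letter m → Set
  IsLeft ℓ = proj₁ ℓ ≡ L

  prune-path : ∀ x y r w → Vertex x → Vertex y → Ahead x y r → ValidWord N m x w → All IsLeft w →
    ValidWord N m y (prune r w) × Ahead (run N m x w) (run N m y (prune r w)) (λ a → r a ∸ crossings a w)
  prune-path x y r [] _ _ ahead _ _ = tt , ahead
  prune-path x y r ((d , i) ∷ w) vx vy ahead (vx' , vw) (refl ∷ lefts) with r (toℕ i) in r≡
  ... | zero =
    let vy' = ahead-vertex x y r i vx' vy ahead r≡
        (vw' , ahead') = prune-path (step (L , i) x) (step (L , i) y) (spend r (L , i)) w vx' vy'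
                                    (ahead-keep x y r (L , i) ahead r≡) vw lefts
    in (vy' , vw') , ahead-cong (run N m (step (L , i) x) w) (budget-after r (L , i) w) ahead'
  ... | suc _ =
    let (vw' , ahead') = prune-path (step (L , i) x) y (spend r (L , i)) w vx' vy
                                    (ahead-skip x y r i ahead (subst (1 ℕ.≤_) (sym r≡) (s≤s z≤n))) vw lefts
    in vw' , ahead-cong (run N m (step (L , i) x) w) (budget-after r (L , i) w) ahead'

  prune-left : ∀ r w → All IsLeft w → All IsLeft (prune r w)
  prune-left r [] [] = []
  prune-left r ((d , i) ∷ w) (left ∷ lefts) with r (toℕ i)
  ... | zero = left ∷ prune-left (spend r (d , i)) w lefts
  ... | suc _ = prune-left (spend r (d , i)) w lefts

  prune-length : ∀ r w → length (prune r w) ℕ.≤ length w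
  prune-length r [] = z≤n
  prune-length r ((d , i) ∷ w) with r (toℕ i)
  ... | zero = s≤s (prune-length (spend r (d , i)) w)
  ... | suc _ = ℕP.m≤n⇒m≤1+n (prune-length (spend r (d , i)) w)

  prune-shortens : ∀ r d i w → 1 ℕ.≤ r (toℕ i) → length (prune r ((d , i) ∷ w)) ℕ.< length ((d , i) ∷ w)
  prune-shortens r d i w r≥1 with r (toℕ i)
  ... | suc _ = s≤s (prune-length (spend r (d , i)) w)

  full : Budget
  full _ = N

  -- with the full budget the original path starts ahead of itself: the pending
  -- displacement is 0 at inner entries and ±N at the ends
  ahead-full : ∀ x → Ahead x x full
  ahead-full x j =
    subst ((+ N) ∣ₛ_) (sym (cancel (x j) (pending full j))) (ℤDiv.∣m⇒∣-m full-divisible) ,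
    λ ne → trans (cong (_+_ (x j)) (full-inner ne)) (ℤP.+-identityʳ (x j))
    where
    cancel : ∀ (a p : ℤ) → a - (a + p) ≡ - p
    cancel = solve-∀
    multiple : ∀ b → (+ N) ∣ₛ (if b then + N else 0ℤ)
    multiple true = ℤDiv.∣-refl
    multiple false = divides-zero _
    carried-multiple : ∀ a → (+ N) ∣ₛ carried full a
    carried-multiple zero = divides-zero _
    carried-multiple (suc b) = ℤDiv.∣-refl
    full-divisible : (+ N) ∣ₛ pending full j
    full-divisible = ℤDiv.∣m∣n⇒∣m-n (multiple (toℕ j ≤ᵇ m)) (carried-multiple (toℕ j))
    full-inner : ¬ IsEnd j → pending full j ≡ 0ℤ
    full-inner ne with toℕ j | inner-bounds j ne
    ... | suc b | _ , j≤m = trans (cong (_- + N) (if-≤ᵇ-yes j≤m)) (ℤP.+-inverseʳ (+ N))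

  pending-spent : ∀ r → (∀ a → a ℕ.≤ m → r a ≡ 0) → ∀ j → pending r j ≡ 0ℤ
  pending-spent r r≡0 j = cong₂ _-_ (own-spent (toℕ j)) (carried-spent (toℕ j) (ℕP.≤-pred (FinP.toℕ<n j)))
    where
    own-spent : ∀ a → own r a ≡ 0ℤ
    own-spent a with a ℕ.≤? m
    ... | yes a≤m = trans (if-≤ᵇ-yes a≤m) (cong +_ (r≡0 a a≤m))
    ... | no a≰m = if-≤ᵇ-no (ℕP.≰⇒> a≰m)
    carried-spent : ∀ a → a ℕ.≤ suc m → carried r a ≡ 0ℤ
    carried-spent zero _ = refl
    carried-spent (suc b) (s≤s b≤m) = cong +_ (r≡0 b b≤m)

  shorter-left-path : ∀ v w → Vertex v → PathToZero N m v w → All IsLeft w →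
    (∀ t → t ℕ.≤ m → N ℕ.≤ crossings t w) →
    Σ (List (Letter m)) λ w' → PathToZero N m v w' × All IsLeft w' × length w' ℕ.< length w
  shorter-left-path v [] _ _ _ enough with enough 0 z≤n
  ... | ()
  shorter-left-path v ((d , i) ∷ w) vv (vw , ends-at-0) lefts enough =
    prune full W , (vw' , pruned-at-0) , prune-left full W lefts , prune-shortens full d i w (s≤s z≤n)
    where
    W : List (Letter m)
    W = (d , i) ∷ w
    pruned : ValidWord N m v (prune full W) ×
             Ahead (run N m v W) (run N m v (prune full W)) (λ a → N ∸ crossings a W)
    pruned = prune-path v v full W vv vv (ahead-full v) vw lefts
    vw' : ValidWord N m v (prune full W)
    vw' = proj₁ pruned
    original-at-0 : IsZero (λ j → run N m v W j + pending (λ a → N ∸ crossings a W) j)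
    original-at-0 j = cong₂ _+_ (ends-at-0 j) (pending-spent _ (λ a a≤m → ℕP.m≤n⇒m∸n≡0 (enough a a≤m)) j)
    pruned-at-0 : IsZero (run N m v (prune full W))
    pruned-at-0 = ≋-zero original-at-0 (run-vertex v (prune full W) vv vw') (proj₂ pruned)

  no-bad-step-on-shortest-left-path : ∀ v w → Vertex v → PathToZero N m v w → All IsLeft w →
    (∀ t → t ℕ.≤ m → 0ℤ ≤ F t v) →
    (∀ w' → PathToZero N m v w' → All IsLeft w' → length w ℕ.≤ length w') →
    ¬ Any LeftFromEmptyRight (steps N m v w)
  no-bad-step-on-shortest-left-path v w vv path lefts F≥0 shortest bad
    with shorter-left-path v w vv path lefts enough
    where
    enough : ∀ t → t ℕ.≤ m → N ℕ.≤ crossings t w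
    enough t t≤m = bad-step-forces-crossings t t≤m v w vv path (All.map inj₂ lefts) (F≥0 t t≤m) bad
  ... | w' , path' , lefts' , shorter = ℕP.<⇒≱ shorter (shortest w' path' lefts')

-- Mirror symmetry: reversing the order of the entries and the direction of
-- the letters is an automorphism of Z_{N,m} exchanging →s_0 with ←s_m,
-- the first entry with the last one, and sumUpTo with sumFrom.

module Mirror (k m : ℕ) where
  open Surgery k m public

  flip : Dir → Dir
  flip L = R
  flip R = L

  δ-flip : ∀ d → δ (flip d) ≡ - δ d
  δ-flip L = refl
  δ-flip R = refl

  neg-δ-flip : ∀ d → - δ (flip d) ≡ δ d
  neg-δ-flip L = refl
  neg-δ-flip R = refl

  mirror : Config m → Config m
  mirror x j = x (opposite j)

  mirror-letter : Letter m → Letter m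
  mirror-letter (d , i) = flip d , opposite i

  _≐_ : Config m → Config m → Set
  x ≐ y = ∀ j → x j ≡ y j

  toℕ-opposite : ∀ (j : Fin (suc (suc m))) → toℕ (opposite j) ≡ suc m ∸ toℕ j
  toℕ-opposite = FinP.opposite-prop

  toℕ-opposite-index : ∀ (i : Fin (suc m)) → toℕ (opposite i) ≡ m ∸ toℕ i
  toℕ-opposite-index = FinP.opposite-prop

  opposite-of-complement : ∀ (j : Fin (suc (suc m))) a → a ℕ.≤ suc m → toℕ j ≡ suc m ∸ a → toℕ (opposite j) ≡ a
  opposite-of-complement j a a≤ j≡ = trans (toℕ-opposite j) (trans (cong (suc m ∸_) j≡) (ℕP.m∸[m∸n]≡n a≤))

  opposite-end : ∀ j → IsEnd j → IsEnd (opposite j)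
  opposite-end j en with end-cases j en
  ... | inj₁ j≡0 = last-is-end (opposite j) (trans (toℕ-opposite j) (cong (suc m ∸_) j≡0))
  ... | inj₂ j≡last = first-is-end (opposite j)
          (trans (toℕ-opposite j) (trans (cong (suc m ∸_) j≡last) (ℕP.n∸n≡0 (suc m))))

  end-of-opposite : ∀ j → IsEnd (opposite j) → IsEnd j
  end-of-opposite j en = subst IsEnd (FinP.opposite-involutive j) (opposite-end (opposite j) en)

  adjust-opposite : ∀ j c z → adjust N m (opposite j) c z ≡ adjust N m j c z
  adjust-opposite j c z with T? (isEndᵇ j)
  ... | yes en = trans (adjust-end (opposite j) c z (opposite-end j en)) (sym (adjust-end j c z en))
  ... | no ne = trans (adjust-inner (opposite j) c z (λ en → ne (end-of-opposite j en))) (sym (adjust-inner j c z ne))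

  toℕ-from-opposite : ∀ j → toℕ j ≡ suc m ∸ toℕ (opposite j)
  toℕ-from-opposite j = trans (cong toℕ (sym (FinP.opposite-involutive j))) (toℕ-opposite (opposite j))

  1+m∸i : ∀ (i : Fin (suc m)) → suc m ∸ toℕ i ≡ suc (toℕ (opposite i))
  1+m∸i i = trans (ℕP.+-∸-assoc 1 (index≤m i)) (cong suc (sym (toℕ-opposite-index i)))

  mirror-step : ∀ ℓ x j → step (mirror-letter ℓ) (mirror x) j ≡ step ℓ x (opposite j)
  mirror-step (d , i) x j with toℕ (opposite j) ℕ.≟ toℕ i | toℕ (opposite j) ℕ.≟ suc (toℕ i)
  ... | yes ĵ≡i | _ = begin
      step (flip d , opposite i) (mirror x) j
    ≡⟨ step-after (flip d) (opposite i) (mirror x) j j≡1+î ⟩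
      adjust N m j (- δ (flip d)) (x (opposite j))
    ≡⟨ cong (λ c → adjust N m j c (x (opposite j))) (neg-δ-flip d) ⟩
      adjust N m j (δ d) (x (opposite j))
    ≡⟨ adjust-opposite j (δ d) (x (opposite j)) ⟨
      adjust N m (opposite j) (δ d) (x (opposite j))
    ≡⟨ step-at d i x (opposite j) ĵ≡i ⟨
      step (d , i) x (opposite j) ∎
    where
    open ≡-Reasoning
    j≡1+î : toℕ j ≡ suc (toℕ (opposite i))
    j≡1+î = trans (toℕ-from-opposite j) (trans (cong (suc m ∸_) ĵ≡i) (1+m∸i i))
  ... | no _ | yes ĵ≡1+i = begin
      step (flip d , opposite i) (mirror x) j
    ≡⟨ step-at (flip d) (opposite i) (mirror x) j j≡î ⟩
      adjust N m j (δ (flip d)) (x (opposite j))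
    ≡⟨ cong (λ c → adjust N m j c (x (opposite j))) (δ-flip d) ⟩
      adjust N m j (- δ d) (x (opposite j))
    ≡⟨ adjust-opposite j (- δ d) (x (opposite j)) ⟨
      adjust N m (opposite j) (- δ d) (x (opposite j))
    ≡⟨ step-after d i x (opposite j) ĵ≡1+i ⟨
      step (d , i) x (opposite j) ∎
    where
    open ≡-Reasoning
    j≡î : toℕ j ≡ toℕ (opposite i)
    j≡î = trans (toℕ-from-opposite j) (trans (cong (suc m ∸_) ĵ≡1+i) (sym (toℕ-opposite-index i)))
  ... | no ĵ≢i | no ĵ≢1+i =
    trans (step-away (flip d) (opposite i) (mirror x) j j≢î j≢1+î) (sym (step-away d i x (opposite j) ĵ≢i ĵ≢1+i))
    where
    j≢î : toℕ j ≢ toℕ (opposite i)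
    j≢î j≡î = ĵ≢1+i (opposite-of-complement j (suc (toℕ i)) (s≤s (index≤m i))
                       (trans j≡î (toℕ-opposite-index i)))
    j≢1+î : toℕ j ≢ suc (toℕ (opposite i))
    j≢1+î j≡1+î = ĵ≢i (opposite-of-complement j (toℕ i) (ℕP.m≤n⇒m≤1+n (index≤m i))
                        (trans j≡1+î (sym (1+m∸i i))))

  step-≐ : ∀ ℓ {x y} → x ≐ y → step ℓ x ≐ step ℓ y
  step-≐ (d , i) {x} {y} x≐y j = cong (λ z → if toℕ j ≡ᵇ toℕ i then adjust N m j (δ d) z
                                       else if toℕ j ≡ᵇ suc (toℕ i) then adjust N m j (- δ d) z else z) (x≐y j)

  vertex-≐ : ∀ {x y} → x ≐ y → Vertex x → Vertex y
  vertex-≐ {x} {y} x≐y vx = record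
    { end-range = λ j en → subst (λ u → (0ℤ ≤ u) × (u < + N)) (x≐y j) (IsVertex.end-range vx j en)
    ; inner-range = λ j ne → subst (λ u → (-1ℤ ≤ u) × (u ≤ 1ℤ)) (x≐y j) (IsVertex.inner-range vx j ne)
    ; sum-zero = subst ((+ N) ℤDivᵤ.∣_) (sum-cong x≐y) (IsVertex.sum-zero vx) }

  mirror-vertex : ∀ x → Vertex x → Vertex (mirror x)
  mirror-vertex x vx = record
    { end-range = λ j en → IsVertex.end-range vx (opposite j) (opposite-end j en)
    ; inner-range = λ j ne → IsVertex.inner-range vx (opposite j) (λ en → ne (end-of-opposite j en))
    ; sum-zero = subst ((+ N) ℤDivᵤ.∣_) (sym (sum-opposite x)) (IsVertex.sum-zero vx) }

  mirror-step-≐ : ∀ ℓ x {y} → y ≐ mirror x → step (mirror-letter ℓ) y ≐ mirror (step ℓ x)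
  mirror-step-≐ ℓ x y≐x̂ j = trans (step-≐ (mirror-letter ℓ) y≐x̂ j) (mirror-step ℓ x j)

  mirror-valid : ∀ x y w → y ≐ mirror x → ValidWord N m x w → ValidWord N m y (map mirror-letter w)
  mirror-valid x y [] _ _ = tt
  mirror-valid x y (ℓ ∷ w) y≐x̂ (vx' , vw) =
    vertex-≐ (λ j → sym (mirror-step-≐ ℓ x y≐x̂ j)) (mirror-vertex (step ℓ x) vx') ,
    mirror-valid (step ℓ x) (step (mirror-letter ℓ) y) w (mirror-step-≐ ℓ x y≐x̂) vw

  mirror-run : ∀ x y w → y ≐ mirror x → run N m y (map mirror-letter w) ≐ mirror (run N m x w)
  mirror-run x y [] y≐x̂ = y≐x̂
  mirror-run x y (ℓ ∷ w) y≐x̂ = mirror-run (step ℓ x) (step (mirror-letter ℓ) y) w (mirror-step-≐ ℓ x y≐x̂)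

  mirror-path : ∀ x y w → y ≐ mirror x → PathToZero N m x w → PathToZero N m y (map mirror-letter w)
  mirror-path x y w y≐x̂ (vw , ends-at-0) =
    mirror-valid x y w y≐x̂ vw , λ j → trans (mirror-run x y w y≐x̂ j) (ends-at-0 (opposite j))

  mirror-involutive : ∀ x → x ≐ mirror (mirror x)
  mirror-involutive x j = cong x (sym (FinP.opposite-involutive j))

  RightFromEmptyLeft : Config m × Letter m → Set
  RightFromEmptyLeft (x , ℓ) = (ℓ ≡ (R , fzero)) × (x fzero ≡ 0ℤ)

  opposite-last : opposite lst ≡ fzero
  opposite-last = FinP.toℕ-injective (opposite-of-complement lst 0 z≤n toℕ-lst)

  mirror-bad : ∀ x y w → y ≐ mirror x → Any RightFromEmptyLeft (steps N m x w) →
    Any LeftFromEmptyRight (steps N m y (map mirror-letter w))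
  mirror-bad x y (ℓ ∷ w) y≐x̂ (here (refl , x₀≡0)) = here (refl , trans (y≐x̂ lst) (trans (cong x opposite-last) x₀≡0))
  mirror-bad x y (ℓ ∷ w) y≐x̂ (there bad) =
    there (mirror-bad (step ℓ x) (step (mirror-letter ℓ) y) w (mirror-step-≐ ℓ x y≐x̂) bad)

  F-mirror : ∀ t → t ℕ.≤ m → ∀ v → F t (mirror v) ≡ sumUpTo (m ∸ t) v
  F-mirror t t≤m v = trans (sum-cong reflect) (sum-opposite (λ i → if toℕ i ≤ᵇ m ∸ t then v i else 0ℤ))
    where
    reflect : ∀ i → above t (mirror v) i ≡ (if toℕ (opposite i) ≤ᵇ m ∸ t then v (opposite i) else 0ℤ)
    reflect i with suc t ℕ.≤? toℕ i
    ... | yes t<i = trans (if-≤ᵇ-yes t<i) (sym (if-≤ᵇ-yes (begin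
        toℕ (opposite i)   ≡⟨ toℕ-opposite i ⟩
        suc m ∸ toℕ i      ≤⟨ ℕP.∸-monoʳ-≤ (suc m) t<i ⟩
        m ∸ t              ∎)))
      where open ℕP.≤-Reasoning
    ... | no t≮i = trans (if-≤ᵇ-no (ℕP.≰⇒> t≮i)) (sym (if-≤ᵇ-no (begin-strict
        m ∸ t              <⟨ ℕP.n<1+n (m ∸ t) ⟩
        suc (m ∸ t)        ≡⟨ ℕP.+-∸-assoc 1 t≤m ⟨
        suc m ∸ t          ≤⟨ ℕP.∸-monoʳ-≤ (suc m) (ℕP.≤-pred (ℕP.≰⇒> t≮i)) ⟩
        suc m ∸ toℕ i      ≡⟨ toℕ-opposite i ⟨
        toℕ (opposite i)   ∎)))
      where open ℕP.≤-Reasoning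

-- Pivot paths and their intervals

module Pivot (k m : ℕ) where
  open Mirror k m

  plus-one : ∀ a → + a + 1ℤ ≡ + suc a
  plus-one a = cong +_ (ℕP.+-comm a 1)

  +1≤ : ∀ {a b} → a ℕ.< b → + a + 1ℤ ≤ + b
  +1≤ {a} {b} a<b = subst (_≤ + b) (sym (plus-one a)) (+≤+ a<b)

  at-coordinate : ∀ {P : ℕ → Set} → (∀ (j : Fin (suc (suc m))) → P (toℕ j)) → ∀ a → a ℕ.≤ suc m → P a
  at-coordinate {P} h a a≤ = subst P (FinP.toℕ-fromℕ< (s≤s a≤)) (h (fromℕ< (s≤s a≤)))

  L≢R : L ≢ R
  L≢R ()

  index≢wall : ∀ w (q : Fin (suc m)) → InnerWall w q → ∀ {d i} → (d , i) ∈ w → toℕ i ≢ toℕ q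
  index≢wall w q q-wall {d} mem i≡q = q-wall d (subst (λ u → (d , u) ∈ w) (FinP.toℕ-injective i≡q) mem)

  -- a pivot path without inner walls that shifts in one direction only is
  -- shortest among all paths to 0 shifting in that direction: its wall is the
  -- end towards which it shifts
  shortest-one-way : ∀ d v w (p : WallPos m) → IsWall w p →
    (∀ w' → PathToZero N m v w' → IsWall w' p → length w ℕ.≤ length w') →
    (∀ q → ¬ InnerWall w q) → (∀ {ℓ} → ℓ ∈ w → proj₁ ℓ ≡ d) →
    ∀ w' → PathToZero N m v w' → All (λ ℓ → proj₁ ℓ ≡ d) w' → length w ℕ.≤ length w'
  shortest-one-way L v w right-end _ shortest _ _ w' path' one-way' =
    shortest w' path' (λ mem → L≢R (sym (All.lookup one-way' mem)))
  shortest-one-way R v w left-end _ shortest _ _ w' path' one-way' =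
    shortest w' path' (λ mem → L≢R (All.lookup one-way' mem))
  shortest-one-way L v w left-end wall _ no-walls one-way =
    ⊥-elim (no-walls fzero λ { L mem → wall mem ; R mem → L≢R (sym (one-way mem)) })
  shortest-one-way R v w right-end wall _ no-walls one-way =
    ⊥-elim (no-walls (fromℕ m) λ { R mem → wall mem ; L mem → L≢R (one-way mem) })
  shortest-one-way d v w (inner q) wall _ no-walls _ = ⊥-elim (no-walls q wall)

  -- Part (1) when the interval starts after an inner wall q: every letter
  -- is admissible for the boundary q, which is never crossed
  part1-after-wall : ∀ v → Vertex v → ∀ w → PathToZero N m v w → (q : Fin (suc m)) → InnerWall w q →
    ShiftsIn L w (+ toℕ q) (+ suc m) → 0ℤ ≤ F (toℕ q) v → ¬ Any LeftFromEmptyRight (steps N m v w)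
  part1-after-wall v vv w path q q-wall shifts F≥0 =
    no-bad-step-behind-wall (toℕ q) (index≤m q) v w vv path (All.tabulate admissible)
      (crossings-none (toℕ q) w (All.tabulate λ mem e → index≢wall w q q-wall mem (sym e))) F≥0
    where
    admissible : ∀ {ℓ} → ℓ ∈ w → Admissible (toℕ q) ℓ
    admissible {d , i} mem with ℕP.<-cmp (toℕ i) (toℕ q)
    ... | tri< i<q _ _ = inj₁ i<q
    ... | tri≈ _ i≡q _ = ⊥-elim (index≢wall w q q-wall mem i≡q)
    ... | tri> _ _ q<i = inj₂ (shifts d i mem (+1≤ q<i) (+1≤ (s≤s (index≤m i))))

  -- Part (1) without inner walls: the path shifts left only and is a shortest such path
  part1-without-walls : ∀ v → Vertex v → ∀ w → PivotPath N m v w → (∀ q → ¬ InnerWall w q) →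
    ShiftsIn L w -1ℤ (+ suc m) → (∀ t → t ℕ.≤ m → 0ℤ ≤ F t v) → ¬ Any LeftFromEmptyRight (steps N m v w)
  part1-without-walls v vv w (p , wall , path , shortest) no-walls shifts F≥0 =
    no-bad-step-on-shortest-left-path v w vv path (All.tabulate left) F≥0
      (shortest-one-way L v w p wall shortest no-walls left)
    where
    left : ∀ {ℓ} → ℓ ∈ w → IsLeft ℓ
    left {d , i} mem = shifts d i mem (+≤+ z≤n) (+1≤ (s≤s (index≤m i)))

  -- Part (2) when the interval ends at an inner wall q: in the mirror image
  -- every letter is admissible for the boundary m - q, which is never crossed
  part2-before-wall : ∀ v → Vertex v → ∀ w → PathToZero N m v w → (q : Fin (suc m)) → InnerWall w q →
    ShiftsIn R w -1ℤ (+ toℕ q) → 0ℤ ≤ sumUpTo (toℕ q) v → ¬ Any RightFromEmptyLeft (steps N m v w)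
  part2-before-wall v vv w path q q-wall shifts nonneg bad =
    no-bad-step-behind-wall t (ℕP.m∸n≤m m (toℕ q)) (mirror v) (map mirror-letter w) (mirror-vertex v vv)
      (mirror-path v (mirror v) w (λ _ → refl) path)
      (map⁺ (All.tabulate admissible)) (crossings-none t _ (map⁺ (All.tabulate uncrossed))) F≥0
      (mirror-bad v (mirror v) w (λ _ → refl) bad)
    where
    t : ℕ
    t = m ∸ toℕ q
    admissible : ∀ {ℓ} → ℓ ∈ w → Admissible t (mirror-letter ℓ)
    admissible {d , i} mem with ℕP.<-cmp (toℕ i) (toℕ q)
    ... | tri< i<q _ _ = inj₂ (cong flip (shifts d i mem (+≤+ z≤n) (+1≤ i<q)))
    ... | tri≈ _ i≡q _ = ⊥-elim (index≢wall w q q-wall mem i≡q)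
    ... | tri> _ _ q<i = inj₁ (subst (ℕ._< t) (sym (toℕ-opposite-index i)) (ℕP.∸-monoʳ-< q<i (index≤m i)))
    uncrossed : ∀ {ℓ} → ℓ ∈ w → t ≢ toℕ (proj₂ (mirror-letter ℓ))
    uncrossed {d , i} mem e = index≢wall w q q-wall mem
      (ℕP.∸-cancelˡ-≡ (index≤m i) (index≤m q) (sym (trans e (toℕ-opposite-index i))))
    F≥0 : 0ℤ ≤ F t (mirror v)
    F≥0 = subst (0ℤ ≤_) (sym (trans (F-mirror t (ℕP.m∸n≤m m (toℕ q)) v)
                                    (cong (λ u → sumUpTo u v) (ℕP.m∸[m∸n]≡n (index≤m q))))) nonneg

  -- Part (2) without inner walls: the mirror image shifts left only and is a
  -- shortest such path, since mirroring preserves lengths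
  part2-without-walls : ∀ v → Vertex v → ∀ w → PivotPath N m v w → (∀ q → ¬ InnerWall w q) →
    ShiftsIn R w -1ℤ (+ suc m) → (∀ a → a ℕ.≤ m → 0ℤ ≤ sumUpTo a v) → ¬ Any RightFromEmptyLeft (steps N m v w)
  part2-without-walls v vv w (p , wall , path , shortest) no-walls shifts nonneg bad =
    no-bad-step-on-shortest-left-path (mirror v) (map mirror-letter w) (mirror-vertex v vv)
      (mirror-path v (mirror v) w (λ _ → refl) path) (map⁺ (All.tabulate (λ mem → cong flip (right mem))))
      (λ t t≤m → subst (0ℤ ≤_) (sym (F-mirror t t≤m v)) (nonneg (m ∸ t) (ℕP.m∸n≤m m t)))
      shortest-left (mirror-bad v (mirror v) w (λ _ → refl) bad)
    where
    right : ∀ {ℓ} → ℓ ∈ w → proj₁ ℓ ≡ R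
    right {d , i} mem = shifts d i mem (+≤+ z≤n) (+1≤ (s≤s (index≤m i)))
    shortest-right : ∀ w' → PathToZero N m v w' → All (λ ℓ → proj₁ ℓ ≡ R) w' → length w ℕ.≤ length w'
    shortest-right = shortest-one-way R v w p wall shortest no-walls right
    shortest-left : ∀ w' → PathToZero N m (mirror v) w' → All IsLeft w' → length (map mirror-letter w) ℕ.≤ length w'
    shortest-left w' path' lefts' =
      subst₂ ℕ._≤_ (sym (length-map mirror-letter w)) (length-map mirror-letter w')
        (shortest-right (map mirror-letter w') (mirror-path (mirror v) v w' (mirror-involutive v) path')
                        (map⁺ (All.map (cong flip) lefts')))

  no-inner-walls : ∀ w → (∀ p → InnerWall w p → ¬ ((-1ℤ < + toℕ p) × (+ toℕ p < + suc m))) →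
    ∀ q → ¬ InnerWall w q
  no-inner-walls w outside q q-wall = outside q q-wall (ℤ.-<+ , +<+ (s≤s (index≤m q)))

  part1 : ∀ v → Vertex v → ∀ w → PivotPath N m v w → ∀ a b → PInterval w a b →
    b ≡ + suc m → ShiftsIn L w a b →
    (∀ (j : Fin (suc (suc m))) → a + 1ℤ ≤ + toℕ j → + toℕ j ≤ b → 0ℤ ≤ sumFrom (toℕ j) v) →
    NoLeftUnitShiftFromEmptyRight N m v w
  part1 v vv w pivot a b (inj₂ (q , refl , q-wall) , _) refl shifts nonneg =
    ¬Any⇒All¬ (steps N m v w) (part1-after-wall v vv w (proj₁ (proj₂ (proj₂ pivot))) q q-wall shifts
                                      (nonneg (fsuc q) (+1≤ ℕP.≤-refl) (+≤+ (s≤s (index≤m q)))))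
  part1 v vv w pivot a b (inj₁ refl , _ , _ , outside) refl shifts nonneg =
    ¬Any⇒All¬ (steps N m v w) (part1-without-walls v vv w pivot (no-inner-walls w outside) shifts
      (λ t t≤m → at-coordinate {λ a → + a ≤ + suc m → 0ℤ ≤ sumFrom a v} (λ j → nonneg j (+≤+ z≤n))
                                (suc t) (s≤s t≤m) (+≤+ (s≤s t≤m))))

  part2 : ∀ v → Vertex v → ∀ w → PivotPath N m v w → ∀ a b → PInterval w a b →
    a ≡ -1ℤ → ShiftsIn R w a b →
    (∀ (j : Fin (suc (suc m))) → a + 1ℤ ≤ + toℕ j → + toℕ j ≤ b → 0ℤ ≤ sumUpTo (toℕ j) v) →
    NoRightUnitShiftFromEmptyLeft N m v w
  part2 v vv w pivot a b (_ , inj₂ (q , refl , q-wall) , _) refl shifts nonneg =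
    ¬Any⇒All¬ (steps N m v w) (part2-before-wall v vv w (proj₁ (proj₂ (proj₂ pivot))) q q-wall shifts
      (at-coordinate {λ a → -1ℤ + 1ℤ ≤ + a → + a ≤ + toℕ q → 0ℤ ≤ sumUpTo a v} nonneg
                     (toℕ q) (ℕP.m≤n⇒m≤1+n (index≤m q)) (+≤+ z≤n) ℤP.≤-refl))
  part2 v vv w pivot a b (_ , inj₁ refl , _ , outside) refl shifts nonneg =
    ¬Any⇒All¬ (steps N m v w) (part2-without-walls v vv w pivot (no-inner-walls w outside) shifts
      (λ a a≤m → at-coordinate {λ a → + a ≤ + suc m → 0ℤ ≤ sumUpTo a v} (λ j → nonneg j (+≤+ z≤n))
                                a (ℕP.m≤n⇒m≤1+n a≤m) (+≤+ (ℕP.m≤n⇒m≤1+n a≤m))))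

lemma5p14 : (n m : ℕ) → 2 ≤ℕ n → 1 ≤ℕ m →
    (v : Config m) → IsVertex n m v →
    (w : List (Letter m)) → PivotPath n m v w →
    (a b : ℤ) → PInterval w a b →
    (b ≡ + suc m → ShiftsIn L w a b →
      (∀ (j : Fin (suc (suc m))) → a + 1ℤ ≤ + toℕ j → + toℕ j ≤ b → 0ℤ ≤ sumFrom (toℕ j) v) →
      NoLeftUnitShiftFromEmptyRight n m v w)
    ×
    (a ≡ -1ℤ → ShiftsIn R w a b →
      (∀ (j : Fin (suc (suc m))) → a + 1ℤ ≤ + toℕ j → + toℕ j ≤ b → 0ℤ ≤ sumUpTo (toℕ j) v) →
      NoRightUnitShiftFromEmptyLeft n m v w)
lemma5p14 zero m () _ v vv w pivot a b interval
lemma5p14 (suc k) m _ _ v vv w pivot a b interval =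
  part1 v vv w pivot a b interval , part2 v vv w pivot a b interval
  where open Pivot k m
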